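{- Let $c\neq 0$ and let $\Phi=(\phi_j)_{j=1}^n$ be a collection of vectors in a non-isotropic space $V$. The following are equivalent: (i) $\Phi\Phi^\dagger u=cu$ for all $u\in\operatorname{im}\Phi$; (ii) $\Phi\Phi^\dagger\Phi=c\Phi$. Moreover, these conditions imply that $\operatorname{im}\Phi$ is non-isotropic and $\Phi:\mathbb{F}^n\to\operatorname{im}\Phi$ is a $c$-tight frame for $\operatorname{im}\Phi$.
   Context: $\mathbb{F}$ is a field with an involution $\sigma$ (possibly the identity). A non-isotropic space is a finite-dimensional $\mathbb{F}$-vector space with a non-degenerate Hermitian scalar product $\langle\cdot,\cdot\rangle$ (linear in the second argument, $\langle u,v\rangle=\langle v,u\rangle^\sigma$, non-degenerate); a subspace is non-isotropic if the restricted form is non-degenerate. $\mathbb{F}^n$ carries $\langle x,y\rangle=\sum_ix_i^\sigma y_i$. The synthesis operator of $\Phi$ is $\Phi:\mathbb{F}^n\to V$, $x\mapsto\sum_jx_j\phi_j$, with adjoint $\Phi^\dagger v=(\langle\phi_j,v\rangle)_j$. $\Phi$ is a $c$-tight frame for a non-isotropic subspace $U$ if its vectors span $U$ and $\Phi\Phi^\dagger u=cu$ for all $u\in U$. -}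

module Defs where

open import Level using (Level; _⊔_) renaming (suc to lsuc)
open import Algebra.Bundles using (CommutativeRing)
open import Algebra.Module.Bundles using (Module)
open import Data.Nat using (ℕ; zero; suc)
open import Data.Fin using (Fin; zero; suc)
open import Data.Product using (Σ; ∃; _×_; _,_)
open import Relation.Nullary using (¬_)

record InvolutiveField (c ℓ : Level) : Set (lsuc (c ⊔ ℓ)) where
  field
    commutativeRing : CommutativeRing c ℓ
  open CommutativeRing commutativeRing public
  field
    0≉1     : ¬ (0# ≈ 1#)
    inverse : ∀ x → ¬ (x ≈ 0#) → ∃ λ y → x * y ≈ 1#
    σ       : Carrier → Carrier
    σ-cong  : ∀ {x y} → x ≈ y → σ x ≈ σ y
    σ-+     : ∀ x y → σ (x + y) ≈ σ x + σ y
    σ-*     : ∀ x y → σ (x * y) ≈ σ x * σ y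
    σ-1     : σ 1# ≈ 1#
    σ-invol : ∀ x → σ (σ x) ≈ x

module _ {c ℓ m ℓm} {R : CommutativeRing c ℓ} (M : Module R m ℓm) where
  open CommutativeRing R using () renaming (Carrier to K)
  open Module M

  lincomb : ∀ {n} → (Fin n → K) → (Fin n → Carrierᴹ) → Carrierᴹ
  lincomb {zero}  x b = 0ᴹ
  lincomb {suc n} x b = (x zero *ₗ b zero) +ᴹ lincomb (λ i → x (suc i)) (λ i → b (suc i))

-- A non-isotropic space: a finite-dimensional F-vector space V with a
-- non-degenerate Hermitian scalar product, linear in the second argument.

record NonIsotropicSpace {c ℓ} (F : InvolutiveField c ℓ) (m ℓm : Level)
       : Set (lsuc (c ⊔ ℓ ⊔ m ⊔ ℓm)) where
  open InvolutiveField F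
  field
    vectorSpace : Module commutativeRing m ℓm
  open Module vectorSpace public
  field
    ⟨_,_⟩    : Carrierᴹ → Carrierᴹ → Carrier
    ⟨⟩-cong  : ∀ {u u′ v v′} → u ≈ᴹ u′ → v ≈ᴹ v′ → ⟨ u , v ⟩ ≈ ⟨ u′ , v′ ⟩
    ⟨⟩-+ʳ    : ∀ u v w → ⟨ u , v +ᴹ w ⟩ ≈ ⟨ u , v ⟩ + ⟨ u , w ⟩
    ⟨⟩-*ʳ    : ∀ a u v → ⟨ u , a *ₗ v ⟩ ≈ a * ⟨ u , v ⟩
    ⟨⟩-herm  : ∀ u v → ⟨ u , v ⟩ ≈ σ ⟨ v , u ⟩
    nondeg   : ∀ u → (∀ v → ⟨ u , v ⟩ ≈ 0#) → u ≈ᴹ 0ᴹ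
    finDim   : Σ ℕ λ k → Σ (Fin k → Carrierᴹ) λ b →
                 ∀ v → Σ (Fin k → Carrier) λ x → v ≈ᴹ lincomb vectorSpace x b

module Frames {c ℓ m ℓm} {F : InvolutiveField c ℓ} (V : NonIsotropicSpace F m ℓm) where
  open InvolutiveField F
  open NonIsotropicSpace V

  synthesis : ∀ {n} → (Fin n → Carrierᴹ) → (Fin n → Carrier) → Carrierᴹ
  synthesis Φ x = lincomb vectorSpace x Φ

  adjoint : ∀ {n} → (Fin n → Carrierᴹ) → Carrierᴹ → (Fin n → Carrier)
  adjoint Φ v j = ⟨ Φ j , v ⟩

  frameOp : ∀ {n} → (Fin n → Carrierᴹ) → Carrierᴹ → Carrierᴹ
  frameOp Φ v = synthesis Φ (adjoint Φ v)

  InIm : ∀ {n} → (Fin n → Carrierᴹ) → Carrierᴹ → Set (c ⊔ ℓm)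
  InIm Φ u = Σ (Fin _ → Carrier) λ x → u ≈ᴹ synthesis Φ x

  IsNonIsotropic : ∀ {p} → (Carrierᴹ → Set p) → Set (p ⊔ m ⊔ ℓ ⊔ ℓm)
  IsNonIsotropic U = ∀ u → U u → (∀ w → U w → ⟨ u , w ⟩ ≈ 0#) → u ≈ᴹ 0ᴹ

  Spans : ∀ {n p} → (Fin n → Carrierᴹ) → (Carrierᴹ → Set p) → Set (p ⊔ c ⊔ m ⊔ ℓm)
  Spans Φ U = (∀ u → U u → InIm Φ u) × (∀ u → InIm Φ u → U u)

  IsTightFrame : ∀ {n p} → Carrier → (Fin n → Carrierᴹ) → (Carrierᴹ → Set p)
                 → Set (p ⊔ c ⊔ ℓ ⊔ m ⊔ ℓm)
  IsTightFrame k Φ U =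
    IsNonIsotropic U × Spans Φ U × (∀ u → U u → frameOp Φ u ≈ᴹ k *ₗ u)

  CondI : ∀ {n} → Carrier → (Fin n → Carrierᴹ) → Set (c ⊔ ℓm ⊔ m)
  CondI k Φ = ∀ u → InIm Φ u → frameOp Φ u ≈ᴹ (k *ₗ u)

  CondII : ∀ {n} → Carrier → (Fin n → Carrierᴹ) → Set (c ⊔ ℓm)
  CondII k Φ = ∀ x → frameOp Φ (synthesis Φ x) ≈ᴹ (k *ₗ synthesis Φ x)

-- The conditions differ only in where the identity ΦΦ†u = ku is demanded: for u ∈ im Φ,
-- or for u = Φx; these are the same vectors.  If u ∈ im Φ is orthogonal to im Φ, it is in
-- particular orthogonal to every φ_j, so Φ†u = 0 and ku = ΦΦ†u = 0; as k is invertible,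
-- u = 0.  Hence im Φ is non-isotropic, and Φ is a k-tight frame for it.
module Submission where

open import Defs
open import Level using (Level)
open import Data.Nat using (ℕ; zero; suc)
open import Data.Fin using (Fin; zero; suc)
open import Data.Product using (_×_; _,_)
open import Relation.Nullary using (¬_)
open import Algebra.Bundles using (CommutativeRing)
open import Algebra.Module.Bundles using (Module)
import Relation.Binary.Reasoning.Setoid as SetoidReasoning

module LinearCombination {c ℓ m ℓm : Level} {R : CommutativeRing c ℓ} (M : Module R m ℓm) where
  open CommutativeRing R using (Carrier; 0#; 1#; _≈_)
  open Module M

  lincomb-cong : ∀ {n} {x y : Fin n → Carrier} (b : Fin n → Carrierᴹ) →
                 (∀ i → x i ≈ y i) → lincomb M x b ≈ᴹ lincomb M y b
  lincomb-cong {zero}  b x≈y = ≈ᴹ-refl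
  lincomb-cong {suc n} b x≈y =
    +ᴹ-cong (*ₗ-cong (x≈y zero) ≈ᴹ-refl) (lincomb-cong (λ i → b (suc i)) (λ i → x≈y (suc i)))

  lincomb-zeroˡ : ∀ {n} (b : Fin n → Carrierᴹ) → lincomb M (λ _ → 0#) b ≈ᴹ 0ᴹ
  lincomb-zeroˡ {zero}  b = ≈ᴹ-refl
  lincomb-zeroˡ {suc n} b =
    ≈ᴹ-trans (+ᴹ-cong (*ₗ-zeroˡ (b zero)) (lincomb-zeroˡ (λ i → b (suc i)))) (+ᴹ-identityˡ 0ᴹ)

  unitVector : ∀ {n} → Fin n → Fin n → Carrier
  unitVector zero    zero    = 1#
  unitVector zero    (suc _) = 0#
  unitVector (suc j) zero    = 0#
  unitVector (suc j) (suc i) = unitVector j i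

  lincomb-unitVector : ∀ {n} (j : Fin n) (b : Fin n → Carrierᴹ) →
                       lincomb M (unitVector j) b ≈ᴹ b j
  lincomb-unitVector zero b =
    ≈ᴹ-trans (+ᴹ-cong (*ₗ-identityˡ (b zero)) (lincomb-zeroˡ (λ i → b (suc i))))
             (+ᴹ-identityʳ (b zero))
  lincomb-unitVector (suc j) b =
    ≈ᴹ-trans (+ᴹ-cong (*ₗ-zeroˡ (b zero)) (lincomb-unitVector j (λ i → b (suc i))))
             (+ᴹ-identityˡ (b (suc j)))

module InvolutiveFieldProperties {c ℓ : Level} (F : InvolutiveField c ℓ) where
  open InvolutiveField F

  σ-0 : σ 0# ≈ 0#
  σ-0 = begin
    σ 0#               ≈⟨ σ-cong (sym (zeroˡ (σ 0#))) ⟩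
    σ (0# * σ 0#)      ≈⟨ σ-* 0# (σ 0#) ⟩
    σ 0# * σ (σ 0#)    ≈⟨ *-congˡ (σ-invol 0#) ⟩
    σ 0# * 0#          ≈⟨ zeroʳ (σ 0#) ⟩
    0#                 ∎
    where open SetoidReasoning setoid

  module _ {m ℓm : Level} (M : Module commutativeRing m ℓm) where
    open Module M

    *ₗ-cancel-≉0 : ∀ {a u} → ¬ (a ≈ 0#) → a *ₗ u ≈ᴹ 0ᴹ → u ≈ᴹ 0ᴹ
    *ₗ-cancel-≉0 {a} {u} a≉0 au≈0 with inverse a a≉0
    ... | a⁻¹ , aa⁻¹≈1 = begin
      u                ≈⟨ ≈ᴹ-sym (*ₗ-identityˡ u) ⟩
      1# *ₗ u          ≈⟨ *ₗ-cong (sym (trans (*-comm a⁻¹ a) aa⁻¹≈1)) ≈ᴹ-refl ⟩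
      (a⁻¹ * a) *ₗ u   ≈⟨ *ₗ-assoc a⁻¹ a u ⟩
      a⁻¹ *ₗ (a *ₗ u)  ≈⟨ *ₗ-congˡ au≈0 ⟩
      a⁻¹ *ₗ 0ᴹ        ≈⟨ *ₗ-zeroʳ a⁻¹ ⟩
      0ᴹ               ∎
      where open SetoidReasoning ≈ᴹ-setoid

module FrameProperties {c ℓ m ℓm : Level} {F : InvolutiveField c ℓ}
                       (V : NonIsotropicSpace F m ℓm) where
  open InvolutiveField F
  open NonIsotropicSpace V
  open Frames V
  open LinearCombination vectorSpace
  open InvolutiveFieldProperties F

  ⟨⟩-orthogonal-sym : ∀ {u v} → ⟨ u , v ⟩ ≈ 0# → ⟨ v , u ⟩ ≈ 0#
  ⟨⟩-orthogonal-sym {u} {v} uv≈0 = trans (⟨⟩-herm v u) (trans (σ-cong uv≈0) σ-0)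

  frameOp-cong : ∀ {n} (Φ : Fin n → Carrierᴹ) {u u′} → u ≈ᴹ u′ → frameOp Φ u ≈ᴹ frameOp Φ u′
  frameOp-cong Φ u≈u′ = lincomb-cong Φ (λ j → ⟨⟩-cong ≈ᴹ-refl u≈u′)

  frameOp-orthogonal : ∀ {n} (Φ : Fin n → Carrierᴹ) {u} →
                       (∀ j → ⟨ Φ j , u ⟩ ≈ 0#) → frameOp Φ u ≈ᴹ 0ᴹ
  frameOp-orthogonal Φ Φ⊥u = ≈ᴹ-trans (lincomb-cong Φ Φ⊥u) (lincomb-zeroˡ Φ)

  φ∈imΦ : ∀ {n} (Φ : Fin n → Carrierᴹ) (j : Fin n) → InIm Φ (Φ j)
  φ∈imΦ Φ j = unitVector j , ≈ᴹ-sym (lincomb-unitVector j Φ)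

  module _ {n} (Φ : Fin n → Carrierᴹ) (k : Carrier) where

    condI⇒condII : CondI k Φ → CondII k Φ
    condI⇒condII eig x = eig (synthesis Φ x) (x , ≈ᴹ-refl)

    condII⇒condI : CondII k Φ → CondI k Φ
    condII⇒condI eig u (x , u≈Φx) =
      ≈ᴹ-trans (frameOp-cong Φ u≈Φx) (≈ᴹ-trans (eig x) (*ₗ-congˡ (≈ᴹ-sym u≈Φx)))

    condI⇒nonIsotropic : ¬ (k ≈ 0#) → CondI k Φ → IsNonIsotropic (InIm Φ)
    condI⇒nonIsotropic k≉0 eig u u∈imΦ u⊥imΦ =
      *ₗ-cancel-≉0 vectorSpace k≉0
        (≈ᴹ-trans (≈ᴹ-sym (eig u u∈imΦ))
                  (frameOp-orthogonal Φ (λ j → ⟨⟩-orthogonal-sym (u⊥imΦ (Φ j) (φ∈imΦ Φ j)))))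

    condI⇒tightFrame : ¬ (k ≈ 0#) → CondI k Φ → IsTightFrame k Φ (InIm Φ)
    condI⇒tightFrame k≉0 eig =
      condI⇒nonIsotropic k≉0 eig , ((λ _ u∈imΦ → u∈imΦ) , (λ _ u∈imΦ → u∈imΦ)) , eig

lemma5p1 : ∀ {c ℓ m ℓm} (F : InvolutiveField c ℓ) (V : NonIsotropicSpace F m ℓm)
             (n : ℕ) (Φ : Fin n → NonIsotropicSpace.Carrierᴹ V)
             (k : InvolutiveField.Carrier F) →
             ¬ (InvolutiveField._≈_ F k (InvolutiveField.0# F)) →
             ((Frames.CondI V k Φ → Frames.CondII V k Φ)
                × (Frames.CondII V k Φ → Frames.CondI V k Φ))
             × (Frames.CondI V k Φ →
                  Frames.IsNonIsotropic V (Frames.InIm V Φ)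
                  × Frames.IsTightFrame V k Φ (Frames.InIm V Φ))
lemma5p1 F V n Φ k k≉0 =
  (condI⇒condII Φ k , condII⇒condI Φ k) ,
  λ eig → condI⇒nonIsotropic Φ k k≉0 eig , condI⇒tightFrame Φ k k≉0 eig
  where open FrameProperties V
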